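{- Let $G$ be a strongly connected ribbon digraph. Every linear equivalence class of divisor-and-rotor configurations $(x,\varrho)$ on $G$ with $\deg(x)\geq 1$ contains a recurrent configuration.
   Context: A digraph here is strongly connected, may have multiple edges, and has no loops. A ribbon digraph is a digraph with, for each vertex $v$, a fixed cyclic ordering of the edges leaving $v$; $e^+$ denotes the edge after $e$. A divisor is $x\in\mathbb{Z}^{V(G)}$, with $\deg(x)=\sum_v x(v)$. A rotor configuration $\varrho$ assigns to each vertex $v$ an edge $\varrho(v)$ with tail $v$. A divisor-and-rotor configuration (DRC) is a pair $(x,\varrho)$. Routing at $v$ transforms $(x,\varrho)$ into $(x',\varrho')$ with $\varrho'(v)=\varrho(v)^+$, $\varrho'(u)=\varrho(u)$ for $u\ne v$, and $x'=x-\mathbf{1}_v+\mathbf{1}_{v'}$ where $v'$ is the head of $\varrho(v)^+$. It is legal if $x(v)>0$, and unconstrained if no condition is imposed. A legal game is a sequence of configurations each obtained from the previous by a legal routing. A DRC is recurrent if some legal game with at least one routing leads from it back to itself. Two DRCs are linearly equivalent if one can be reached from the other by a sequence of unconstrained routings (this is an equivalence relation, preserving the degree of the divisor). -}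

module Defs where

open import Data.Nat using (ℕ; zero; suc)
open import Data.Fin using (Fin)
open import Data.Integer using (ℤ; _+_; _-_; _<_; _≥_; 0ℤ; 1ℤ)
open import Data.Vec using (Vec; lookup; foldr; _[_]≔_; _[_]%=_)
open import Data.Product using (Σ; _×_; _,_; ∃)
open import Relation.Binary.PropositionalEquality using (_≡_; _≢_)
open import Relation.Nullary using (¬_)
open import Relation.Binary.Construct.Closure.ReflexiveTransitive using (Star)

iter : {A : Set} → (A → A) → ℕ → A → A
iter f zero    a = a
iter f (suc k) a = f (iter f k a)

record Digraph (n m : ℕ) : Set where
  field
    tail : Fin m → Fin n
    head : Fin m → Fin n
    loopless : ∀ e → tail e ≢ head e

open Digraph public

data Path {n m : ℕ} (G : Digraph n m) : Fin n → Fin n → Set where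
  here : ∀ {v} → Path G v v
  step : ∀ {u w} (e : Fin m) → tail G e ≡ u → Path G (head G e) w → Path G u w

StronglyConnected : {n m : ℕ} → Digraph n m → Set
StronglyConnected G = ∀ u v → Path G u v

-- A ribbon digraph: for each vertex, a cyclic ordering of its out-edges,
-- given by the successor map e ↦ e⁺ which preserves tails and whose
-- restriction to the out-edges of each vertex is a single cycle.
record RibbonDigraph (n m : ℕ) : Set where
  field
    graph : Digraph n m
    next  : Fin m → Fin m
    next-tail : ∀ e → tail graph (next e) ≡ tail graph e
    next-cyclic : ∀ e e' → tail graph e ≡ tail graph e' →
                  ∃ λ k → iter next k e ≡ e'

open RibbonDigraph public

Divisor : ℕ → Set
Divisor n = Vec ℤ n

deg : {n : ℕ} → Divisor n → ℤ
deg = foldr _ _+_ 0ℤ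

record DRC {n m : ℕ} (G : RibbonDigraph n m) : Set where
  constructor drc
  field
    divisor : Divisor n
    rotor   : Vec (Fin m) n
    rotor-tail : ∀ v → tail (graph G) (lookup rotor v) ≡ v

open DRC public

SameConfig : {n m : ℕ} {G : RibbonDigraph n m} → DRC G → DRC G → Set
SameConfig c d = (divisor c ≡ divisor d) × (rotor c ≡ rotor d)

Routes : {n m : ℕ} (G : RibbonDigraph n m) → Fin n → DRC G → DRC G → Set
Routes G v c c' =
  let e⁺ = next G (lookup (rotor c) v) in
  (rotor c' ≡ rotor c [ v ]≔ e⁺) ×
  (divisor c' ≡ ((divisor c [ v ]%= (λ a → a - 1ℤ)) [ head (graph G) e⁺ ]%= (λ a → a + 1ℤ)))

URoute : {n m : ℕ} (G : RibbonDigraph n m) → DRC G → DRC G → Set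
URoute G c c' = ∃ λ v → Routes G v c c'

LRoute : {n m : ℕ} (G : RibbonDigraph n m) → DRC G → DRC G → Set
LRoute G c c' = ∃ λ v → (0ℤ < lookup (divisor c) v) × Routes G v c c'

LinearlyEquivalent : {n m : ℕ} (G : RibbonDigraph n m) → DRC G → DRC G → Set
LinearlyEquivalent G = Star (URoute G)

Recurrent : {n m : ℕ} (G : RibbonDigraph n m) → DRC G → Set
Recurrent G c = ∃ λ d → ∃ λ c' →
  LRoute G c d × Star (LRoute G) d c' × SameConfig c' c

module Submission where

-- Starting from c, play the greedy legal game: as long as the degree
-- D is at least 1 some vertex carries a positive number of chips, so a legal
-- routing is always available and the game runs forever.  Legal routings
-- keep the degree equal to D and never push an entry below
-- L = min(0, min c) (only positive entries are decreased, and only by one).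
-- Entries bounded below by L with total D are also bounded above, so the
-- game visits only finitely many configurations.  By pigeonhole some
-- configuration r is visited twice; r is reached from c by routings, so it
-- is linearly equivalent to c, and the game from r back to r shows that r
-- is recurrent.

open import Defs
open import Data.Nat using (ℕ; zero; suc; s≤s; _^_)
import Data.Nat as ℕ
import Data.Nat.Properties as ℕP
open import Data.Integer
  using (ℤ; +_; ∣_∣; _+_; _-_; -_; _≤_; _<_; _≥_; 0ℤ; 1ℤ; _⊓_; +≤+)
import Data.Integer.Properties as ZP
open import Data.Integer.Tactic.RingSolver using (solve-∀)
open import Data.Fin using (Fin; zero; suc; toℕ; fromℕ<; combine; _≟_)
import Data.Fin.Properties as FP
open import Data.Vec using (Vec; []; _∷_; lookup; map; replicate; _[_]%=_; _[_]≔_)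
open import Data.Vec.Properties
  using (lookup∘updateAt; lookup∘updateAt′; lookup-replicate; ∷-injective)
open import Data.Product using (Σ; ∃; _×_; _,_; proj₁; proj₂)
open import Data.Empty using (⊥-elim)
open import Relation.Nullary using (¬_; yes; no)
open import Relation.Binary.PropositionalEquality
open import Relation.Binary.Construct.Closure.ReflexiveTransitive
  using (Star; ε; _◅_; _◅◅_; gmap)

-- The property may depend on
-- the position, so this covers both divisor bounds and rotor tails.
updateAt-preserves : ∀ {A : Set} {n} (P : Fin n → A → Set) (xs : Vec A n) i (f : A → A) →
                     (∀ w → P w (lookup xs w)) → P i (f (lookup xs i)) →
                     ∀ w → P w (lookup (xs [ i ]%= f) w)
updateAt-preserves P xs i f all-P P-new w with w ≟ i
... | yes refl = subst (P w) (sym (lookup∘updateAt w xs)) P-new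
... | no w≢i   = subst (P w) (sym (lookup∘updateAt′ w i w≢i xs)) (all-P w)

deg-updateAt : ∀ {n} (xs : Vec ℤ n) i (f : ℤ → ℤ) →
               deg (xs [ i ]%= f) ≡ deg xs + (f (lookup xs i) - lookup xs i)
deg-updateAt (a ∷ as) zero f = shift (f a) a (deg as)
  where
    shift : ∀ b a d → b + d ≡ (a + d) + (b - a)
    shift = solve-∀
deg-updateAt (a ∷ as) (suc i) f =
  trans (cong (λ t → a + t) (deg-updateAt as i f)) (sym (ZP.+-assoc a (deg as) _))

deg-mono : ∀ {n} (xs ys : Vec ℤ n) → (∀ w → lookup xs w ≤ lookup ys w) → deg xs ≤ deg ys
deg-mono []       []       _  = ZP.≤-refl
deg-mono (a ∷ as) (b ∷ bs) le = ZP.+-mono-≤ (le zero) (deg-mono as bs (λ w → le (suc w)))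

deg-zeros : ∀ n → deg (replicate n 0ℤ) ≡ 0ℤ
deg-zeros zero    = refl
deg-zeros (suc n) = trans (ZP.+-identityˡ _) (deg-zeros n)

positive-entry : ∀ {n} (xs : Vec ℤ n) → 1ℤ ≤ deg xs → ∃ λ v → 0ℤ < lookup xs v
positive-entry {n} xs deg≥1 with FP.any? (λ v → 0ℤ ZP.<? lookup xs v)
... | yes found = found
... | no none   = ⊥-elim (1≰0 (ZP.≤-trans deg≥1 (subst (deg xs ≤_) (deg-zeros n) deg≤0)))
  where
    deg≤0 : deg xs ≤ deg (replicate n 0ℤ)
    deg≤0 = deg-mono xs (replicate n 0ℤ) λ w →
      subst (lookup xs w ≤_) (sym (lookup-replicate w 0ℤ)) (ZP.≮⇒≥ (λ pos → none (w , pos)))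
    1≰0 : ¬ (1ℤ ≤ 0ℤ)
    1≰0 (+≤+ ())

-- If every entry is at least L ≤ 0, then every entry is at most
-- deg xs - n·L: replacing that entry by 0 leaves a divisor still bounded
-- below by L, whose degree is therefore at least n·L = deg (replicate n L).
entry-bounded-above : ∀ {n} (xs : Vec ℤ n) L → L ≤ 0ℤ → (∀ w → L ≤ lookup xs w) →
                      ∀ v → lookup xs v ≤ deg xs - deg (replicate n L)
entry-bounded-above {n} xs L L≤0 L≤xs v = rearrange {d = deg xs} (begin
    deg (replicate n L)          ≤⟨ deg-mono (replicate n L) ys L≤ys ⟩
    deg ys                       ≡⟨ deg-updateAt xs v (λ _ → 0ℤ) ⟩
    deg xs + (0ℤ - lookup xs v)  ∎)
  where
    open ZP.≤-Reasoning
    ys = xs [ v ]%= (λ _ → 0ℤ)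

    L≤ys : ∀ w → lookup (replicate n L) w ≤ lookup ys w
    L≤ys w = subst (_≤ lookup ys w) (sym (lookup-replicate w L))
               (updateAt-preserves (λ _ → L ≤_) xs v (λ _ → 0ℤ) L≤xs L≤0 w)

    rearrange : ∀ {R d} → R ≤ d + (0ℤ - lookup xs v) → lookup xs v ≤ d - R
    rearrange {R} {d} le = ZP.0≤i-j⇒j≤i
      (subst (0ℤ ≤_) (identity R d (lookup xs v)) (ZP.i≤j⇒0≤j-i le))
      where
        identity : ∀ R d x → (d + (0ℤ - x)) - R ≡ (d - R) - x
        identity = solve-∀

module Routing {n m : ℕ} (G : RibbonDigraph n m) where

  advanced : DRC G → Fin n → Fin m
  advanced d v = next G (lookup (rotor d) v)

  target : DRC G → Fin n → Fin n
  target d v = head (graph G) (advanced d v)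

  route : DRC G → Fin n → DRC G
  route d v = drc
    ((divisor d [ v ]%= (λ a → a - 1ℤ)) [ target d v ]%= (λ a → a + 1ℤ))
    (rotor d [ v ]≔ advanced d v)
    (updateAt-preserves (λ w e → tail (graph G) e ≡ w) (rotor d) v _
       (rotor-tail d) (trans (next-tail G _) (rotor-tail d v)))

  route-Routes : ∀ d v → Routes G v d (route d v)
  route-Routes d v = refl , refl

  deg-route : ∀ d v → deg (divisor (route d v)) ≡ deg (divisor d)
  deg-route d v = begin
      deg ((x [ v ]%= (λ a → a - 1ℤ)) [ t ]%= (λ a → a + 1ℤ))
    ≡⟨ deg-updateAt (x [ v ]%= (λ a → a - 1ℤ)) t (λ a → a + 1ℤ) ⟩
      deg (x [ v ]%= (λ a → a - 1ℤ)) + ((y + 1ℤ) - y)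
    ≡⟨ cong (_+ ((y + 1ℤ) - y)) (deg-updateAt x v (λ a → a - 1ℤ)) ⟩
      (deg x + ((lookup x v - 1ℤ) - lookup x v)) + ((y + 1ℤ) - y)
    ≡⟨ chip-moved (deg x) (lookup x v) y ⟩
      deg x
    ∎
    where
      open ≡-Reasoning
      x = divisor d
      t = target d v
      y = lookup (x [ v ]%= (λ a → a - 1ℤ)) t
      chip-moved : ∀ D a b → (D + ((a - 1ℤ) - a)) + ((b + 1ℤ) - b) ≡ D
      chip-moved = solve-∀

  -- A legal routing keeps every entry at least L when L ≤ 0: the routed
  -- entry was positive before losing its chip, and the other change is a gain.
  route-bounded-below : ∀ d v L → L ≤ 0ℤ → (∀ w → L ≤ lookup (divisor d) w) →
                        0ℤ < lookup (divisor d) v → ∀ w → L ≤ lookup (divisor (route d v)) w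
  route-bounded-below d v L L≤0 L≤x pos =
    updateAt-preserves (λ _ → L ≤_) x₁ (target d v) (λ a → a + 1ℤ) L≤x₁
      (subst (L ≤_) (ZP.+-comm 1ℤ (lookup x₁ (target d v))) (ZP.i≤j⇒i≤1+j (L≤x₁ (target d v))))
    where
      x₁ = divisor d [ v ]%= (λ a → a - 1ℤ)
      L≤x₁ : ∀ w → L ≤ lookup x₁ w
      L≤x₁ = updateAt-preserves (λ _ → L ≤_) (divisor d) v _ L≤x
        (ZP.≤-trans L≤0 (subst (0ℤ ≤_) (ZP.+-comm (- 1ℤ) (lookup (divisor d) v)) (ZP.i<j⇒i≤pred[j] pos)))

  legal⇒linear : ∀ {c d} → Star (LRoute G) c d → LinearlyEquivalent G c d
  legal⇒linear = gmap (λ d → d) (λ { (v , _ , routes) → v , routes })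

encode : ∀ {m k} → Vec (Fin m) k → Fin (m ^ k)
encode []       = zero
encode (a ∷ as) = combine a (encode as)

encode-injective : ∀ {m k} (xs ys : Vec (Fin m) k) → encode xs ≡ encode ys → xs ≡ ys
encode-injective [] [] _ = refl
encode-injective (a ∷ as) (b ∷ bs) eq
  with FP.combine-injective a (encode as) b (encode bs) eq
... | refl , eq′ = cong (a ∷_) (encode-injective as bs eq′)

map-injectiveOn : ∀ {A B : Set} {k} (P : A → Set) (f : A → B) →
                  (∀ {x y} → P x → P y → f x ≡ f y → x ≡ y) →
                  (xs ys : Vec A k) → (∀ w → P (lookup xs w)) → (∀ w → P (lookup ys w)) →
                  map f xs ≡ map f ys → xs ≡ ys
map-injectiveOn P f inj [] [] _ _ _ = refl
map-injectiveOn P f inj (a ∷ as) (b ∷ bs) Pxs Pys eq with ∷-injective eq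
... | fa≡fb , eq′ = cong₂ _∷_ (inj (Pxs zero) (Pys zero) fa≡fb)
                      (map-injectiveOn P f inj as bs (λ w → Pxs (suc w)) (λ w → Pys (suc w)) eq′)

InInterval : ℤ → ℤ → ℤ → Set
InInterval L U x = (L ≤ x) × (x ≤ U)

-- The position x - L of an integer in [L, U], as an element of a finite set
-- (clamped so that it is defined everywhere).
slot : (L U : ℤ) → ℤ → Fin (suc ∣ U - L ∣)
slot L U x = fromℕ< (s≤s (ℕP.m⊓n≤n ∣ x - L ∣ ∣ U - L ∣))

slot-injective : ∀ L U {x y} → InInterval L U x → InInterval L U y →
                 slot L U x ≡ slot L U y → x ≡ y
slot-injective L U {x} {y} x∈ y∈ eq = begin
    x                  ≡⟨ shift x ⟩
    (x - L) + L        ≡⟨ cong (_+ L) (sym (offset x∈)) ⟩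
    + ∣ x - L ∣ + L    ≡⟨ cong (λ k → + k + L) offsets-equal ⟩
    + ∣ y - L ∣ + L    ≡⟨ cong (_+ L) (offset y∈) ⟩
    (y - L) + L        ≡⟨ sym (shift y) ⟩
    y                  ∎
  where
    open ≡-Reasoning
    shift : ∀ z → z ≡ (z - L) + L
    shift z = subtract-add z L
      where
        subtract-add : ∀ z L → z ≡ (z - L) + L
        subtract-add = solve-∀

    offset : ∀ {z} → InInterval L U z → + ∣ z - L ∣ ≡ z - L
    offset (L≤z , _) = ZP.0≤i⇒+∣i∣≡i (ZP.i≤j⇒0≤j-i L≤z)

    offset-bounded : ∀ {z} → InInterval L U z → ∣ z - L ∣ ℕ.≤ ∣ U - L ∣
    offset-bounded {z} z∈@(L≤z , z≤U) = ZP.drop‿+≤+ (subst₂ _≤_ (sym (offset z∈))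
      (sym (ZP.0≤i⇒+∣i∣≡i (ZP.i≤j⇒0≤j-i (ZP.≤-trans L≤z z≤U))))
      (ZP.+-monoˡ-≤ (- L) z≤U))

    offsets-equal : ∣ x - L ∣ ≡ ∣ y - L ∣
    offsets-equal = begin
      ∣ x - L ∣                 ≡⟨ sym (ℕP.m≤n⇒m⊓n≡m (offset-bounded x∈)) ⟩
      ∣ x - L ∣ ℕ.⊓ ∣ U - L ∣   ≡⟨ sym (FP.toℕ-fromℕ< _) ⟩
      toℕ (slot L U x)          ≡⟨ cong toℕ eq ⟩
      toℕ (slot L U y)          ≡⟨ FP.toℕ-fromℕ< _ ⟩
      ∣ y - L ∣ ℕ.⊓ ∣ U - L ∣   ≡⟨ ℕP.m≤n⇒m⊓n≡m (offset-bounded y∈) ⟩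
      ∣ y - L ∣                 ∎

module _ {A : Set} (R S : A → A → Set) where

  -- a returns to itself (up to S) by a nonempty R-path; for R = LRoute G and
  -- S = SameConfig this is exactly Recurrent G.
  Returns : A → Set
  Returns a = ∃ λ b → ∃ λ a′ → R a b × Star R b a′ × S a′ a

  run-segment : (s : ℕ → A) → (∀ k → R (s k) (s (suc k))) →
                ∀ i k → Star R (s i) (s (k ℕ.+ i))
  run-segment s steps i zero    = ε
  run-segment s steps i (suc k) = run-segment s steps i k ◅◅ (steps (k ℕ.+ i) ◅ ε)

  run-returns : ∀ {N} (s : ℕ → A) → (∀ k → R (s k) (s (suc k))) →
                (code : ℕ → Fin N) → (∀ i j → code i ≡ code j → S (s j) (s i)) →
                ∃ λ i → Star R (s 0) (s i) × Returns (s i)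
  run-returns {N} s steps code sound
    with FP.pigeonhole (ℕP.n<1+n N) (λ i → code (toℕ i))
  ... | i , j , i<j , same-code =
    toℕ i ,
    subst (λ k → Star R (s 0) (s k)) (ℕP.+-identityʳ (toℕ i)) (run-segment s steps 0 (toℕ i)) ,
    s (suc (toℕ i)) , s (toℕ j) , steps (toℕ i) ,
    subst (λ k → Star R (s (suc (toℕ i))) (s k)) (ℕP.m∸n+n≡m i<j)
      (run-segment s steps (suc (toℕ i)) (toℕ j ℕ.∸ suc (toℕ i))) ,
    sound (toℕ i) (toℕ j) same-code

floor : ∀ {n} → Vec ℤ n → ℤ
floor []       = 0ℤ
floor (a ∷ as) = a ⊓ floor as

floor≤0 : ∀ {n} (xs : Vec ℤ n) → floor xs ≤ 0ℤ
floor≤0 []       = ZP.≤-refl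
floor≤0 (a ∷ as) = ZP.i≤j⇒k⊓i≤j a (floor≤0 as)

floor≤entry : ∀ {n} (xs : Vec ℤ n) w → floor xs ≤ lookup xs w
floor≤entry (a ∷ as) zero    = ZP.i⊓j≤i a (floor as)
floor≤entry (a ∷ as) (suc w) = ZP.i≤j⇒k⊓i≤j a (floor≤entry as w)

module GreedyGame {n m : ℕ} (G : RibbonDigraph n m) (c : DRC G) (deg≥1 : deg (divisor c) ≥ 1ℤ) where
  open Routing G

  -- Degree of c, lower bound L ≤ 0 for the entries of c, and the upper
  -- bound D - n·L that entries bounded below by L and summing to D obey.
  D L U : ℤ
  D = deg (divisor c)
  L = floor (divisor c)
  U = D - deg (replicate n L)

  Invariant : DRC G → Set
  Invariant d = (∀ w → L ≤ lookup (divisor d) w) × (deg (divisor d) ≡ D)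

  legal-step : ∀ d → Invariant d → Σ (DRC G) λ d′ → Invariant d′ × LRoute G d d′
  legal-step d (L≤d , deg≡D) with positive-entry (divisor d) (subst (1ℤ ≤_) (sym deg≡D) deg≥1)
  ... | v , pos = route d v ,
                  (route-bounded-below d v L (floor≤0 (divisor c)) L≤d pos , trans (deg-route d v) deg≡D) ,
                  v , pos , route-Routes d v

  game : ℕ → Σ (DRC G) Invariant
  game zero    = c , floor≤entry (divisor c) , refl
  game (suc k) = let (d′ , inv′ , _) = legal-step (proj₁ (game k)) (proj₂ (game k)) in d′ , inv′

  position : ℕ → DRC G
  position k = proj₁ (game k)

  moves : ∀ k → LRoute G (position k) (position (suc k))
  moves k = proj₂ (proj₂ (legal-step (proj₁ (game k)) (proj₂ (game k))))

  in-interval : ∀ k w → InInterval L U (lookup (divisor (position k)) w)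
  in-interval k w with game k
  ... | d , L≤d , deg≡D = L≤d w ,
    subst (λ e → lookup (divisor d) w ≤ e - deg (replicate n L)) deg≡D
      (entry-bounded-above (divisor d) L (floor≤0 (divisor c)) L≤d w)

  code : DRC G → Fin (suc ∣ U - L ∣ ^ n ℕ.* m ^ n)
  code d = combine (encode (map (slot L U) (divisor d))) (encode (rotor d))

  code-sound : ∀ i j → code (position i) ≡ code (position j) → SameConfig (position j) (position i)
  code-sound i j eq with FP.combine-injective _ _ _ _ eq
  ... | divisors , rotors =
    sym (map-injectiveOn (InInterval L U) (slot L U) (slot-injective L U) _ _
           (in-interval i) (in-interval j) (encode-injective _ _ divisors)) ,
    sym (encode-injective _ _ rotors)

lemma3p11 : {n m : ℕ} (G : RibbonDigraph n m) → StronglyConnected (graph G) →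
    (c : DRC G) → deg (divisor c) ≥ 1ℤ →
    ∃ λ r → LinearlyEquivalent G c r × Recurrent G r
lemma3p11 G _ c deg≥1 =
  let (i , reached , returns) =
        run-returns (LRoute G) SameConfig position moves (λ k → code (position k)) code-sound
  in position i , Routing.legal⇒linear G reached , returns
  where open GreedyGame G c deg≥1
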